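{- Let $X$ be a non-empty set of positive integers with $X\neq\{1\}$. At least one of $\Delta(X),\Gamma(X)$ contains a triangle (a cycle of length $3$) if and only if $B(X)$ contains an induced subgraph isomorphic to $C_6$ or to $K_{1,3}$.
   Context: For a non-empty set $X$ of positive integers, $\rho(X)$ is the set of primes dividing some element of $X$ and $X^*=X\setminus\{1\}$. $B(X)$ is the bipartite graph with vertex set the disjoint union $\rho(X)\cup X^*$ and edges $\{p,x\}$ for $p\in\rho(X)$, $x\in X^*$, $p\mid x$. $\Delta(X)$ has vertex set $\rho(X)$, distinct $p,q$ adjacent iff $pq$ divides some element of $X$. $\Gamma(X)$ has vertex set $X^*$, distinct $x,y$ adjacent iff $\gcd(x,y)>1$. $C_6$ is the cycle on $6$ vertices and $K_{1,3}$ the complete bipartite graph with parts of sizes $1$ and $3$. -}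

module Defs where

open import Level using (0ℓ)
open import Data.Nat using (ℕ; zero; suc; _*_; _<_; _%_)
open import Data.Nat.Divisibility using (_∣_)
open import Data.Nat.GCD using (gcd)
open import Data.Nat.Primality using (Prime)
open import Data.Fin using (Fin; toℕ)
import Data.Fin as F
open import Data.Product using (Σ; ∃; _×_; proj₁)
open import Data.Sum using (_⊎_; inj₁; inj₂)
open import Data.Empty using (⊥)
open import Relation.Nullary using (¬_)
open import Relation.Binary.PropositionalEquality using (_≡_; _≢_)
open import Function.Bundles using (_⇔_)

NatSet : Set₁
NatSet = ℕ → Set

InRho : NatSet → ℕ → Set
InRho X p = Prime p × ∃ λ x → X x × p ∣ x

InXStar : NatSet → ℕ → Set
InXStar X x = X x × x ≢ 1

DeltaAdj : NatSet → ℕ → ℕ → Set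
DeltaAdj X p q = p ≢ q × ∃ λ x → X x × (p * q) ∣ x

GammaAdj : ℕ → ℕ → Set
GammaAdj x y = x ≢ y × 1 < gcd x y

DeltaTriangle : NatSet → Set
DeltaTriangle X = Σ ℕ λ p → Σ ℕ λ q → Σ ℕ λ r →
  InRho X p × InRho X q × InRho X r ×
  DeltaAdj X p q × DeltaAdj X q r × DeltaAdj X p r

GammaTriangle : NatSet → Set
GammaTriangle X = Σ ℕ λ x → Σ ℕ λ y → Σ ℕ λ z →
  InXStar X x × InXStar X y × InXStar X z ×
  GammaAdj x y × GammaAdj y z × GammaAdj x z

BVert : NatSet → Set
BVert X = Σ ℕ (InRho X) ⊎ Σ ℕ (InXStar X)

-- the underlying label of a vertex (side tag + number), used for distinctness
BLabel : {X : NatSet} → BVert X → ℕ ⊎ ℕ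
BLabel (inj₁ v) = inj₁ (proj₁ v)
BLabel (inj₂ v) = inj₂ (proj₁ v)

BAdj : {X : NatSet} → BVert X → BVert X → Set
BAdj (inj₁ p) (inj₂ x) = proj₁ p ∣ proj₁ x
BAdj (inj₂ x) (inj₁ p) = proj₁ p ∣ proj₁ x
BAdj (inj₁ _) (inj₁ _) = ⊥
BAdj (inj₂ _) (inj₂ _) = ⊥

C6Adj : Fin 6 → Fin 6 → Set
C6Adj i j = (toℕ j ≡ suc (toℕ i) % 6) ⊎ (toℕ i ≡ suc (toℕ j) % 6)

K13Adj : Fin 4 → Fin 4 → Set
K13Adj i j = (i ≡ F.zero × j ≢ F.zero) ⊎ (j ≡ F.zero × i ≢ F.zero)

InducedIn : (X : NatSet) (n : ℕ) → (Fin n → Fin n → Set) → Set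
InducedIn X n H = Σ (Fin n → BVert X) λ f →
  (∀ i j → BLabel {X} (f i) ≡ BLabel {X} (f j) → i ≡ j) ×
  (∀ i j → BAdj {X} (f i) (f j) ⇔ H i j)

-- Both triangles produce the same configuration in B(X): primes P₀ P₁ P₂ and
-- numbers N₀ N₁ N₂ with Pᵢ ∣ Nⱼ whenever i ≠ j (for a Δ-triangle, Nₖ witnesses
-- the edge opposite Pₖ; for a Γ-triangle, Pₖ is a prime factor of the gcd on
-- the edge opposite Nₖ). If no Pₖ divides Nₖ this is K₃,₃ minus a perfect
-- matching, an induced C₆; otherwise Pₖ divides every Nⱼ and every Pᵢ divides
-- Nₖ, so Pₖ or Nₖ is the centre of an induced K₁,₃ whose leaves are the family
-- known to be pairwise distinct (the triangle's vertices). Conversely the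
-- leaves of an induced K₁,₃, and every other vertex of an induced C₆, are
-- pairwise at distance two in B(X), which means Δ- or Γ-adjacent.
module Submission where

open import Defs
open import Data.Nat using (ℕ; suc; _<_; _*_; _%_; z≤n; s≤s; nonTrivial⇒≢1)
import Data.Nat as ℕ
open import Data.Nat.Properties using (*-comm; n>0⇒n≢0)
open import Data.Nat.Divisibility
  using (_∣_; _∣?_; divides; ∣-trans; ∣1⇒≡1; *-monoˡ-∣; m*n∣⇒m∣; m*n∣⇒n∣)
open import Data.Nat.GCD using (gcd; gcd[m,n]∣m; gcd[m,n]∣n; gcd-greatest; gcd[m,n]≢0)
open import Data.Nat.Coprimality using (Coprime; coprime-divisor)
open import Data.Nat.ListAction using (product)
open import Data.Nat.Primality using (Prime; prime⇒irreducible; prime⇒nonTrivial)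
open import Data.Nat.Primality.Factorisation using (factorise)
open import Data.Fin using (Fin; suc; toℕ; _≟_)
open import Data.Fin.Patterns using (0F; 1F; 2F; 3F; 4F; 5F)
open import Data.Fin.Properties using (all?; any?)
open import Data.List using (_∷_)
open import Data.List.Relation.Unary.All using (_∷_)
open import Data.Product using (∃; ∃-syntax; Σ; _×_; _,_; proj₁)
open import Data.Sum using (_⊎_; inj₁; inj₂; [_,_])
import Data.Sum as Sum
open import Data.Sum.Properties using (inj₁-injective; inj₂-injective; ≡-dec)
open import Data.Unit using (⊤; tt)
open import Data.Empty using (⊥)
open import Function using (_∘_; id; const)
open import Function.Bundles using (_⇔_; mk⇔; Equivalence)
open import Function.Construct.Composition using (_⇔-∘_)
open import Function.Definitions using (Injective)
open import Relation.Nullary using (¬_; Dec; yes; no; ¬?)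
open import Relation.Nullary.Decidable using (True; toWitness; map′; _×-dec_; _⊎-dec_; _→-dec_)
open import Relation.Nullary.Negation using (contradiction)
open import Relation.Binary.PropositionalEquality
  using (_≡_; _≢_; refl; sym; trans; cong; subst; ≢-sym)

prime-divisor : ∀ n → 1 < n → ∃[ p ] Prime p × p ∣ n
prime-divisor 1 (s≤s ())
prime-divisor n@(suc (suc _)) _ with factorise n
... | record { factors = p ∷ ps ; isFactorisation = n≡p*Πps ; factorsPrime = p-prime ∷ _ } =
  p , p-prime , divides (product ps) (trans n≡p*Πps (*-comm p (product ps)))

common-prime-divisor : ∀ {m n} → 1 < gcd m n → ∃[ p ] Prime p × p ∣ m × p ∣ n
common-prime-divisor {m} {n} 1<gcd with prime-divisor (gcd m n) 1<gcd
... | p , p-prime , p∣gcd =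
  p , p-prime , ∣-trans p∣gcd (gcd[m,n]∣m m n) , ∣-trans p∣gcd (gcd[m,n]∣n m n)

prime∣⇒≢1 : ∀ {p n} → Prime p → p ∣ n → n ≢ 1
prime∣⇒≢1 p-prime p∣n refl = nonTrivial⇒≢1 {{prime⇒nonTrivial p-prime}} (∣1⇒≡1 p∣n)

prime∣∧≢0⇒1< : ∀ {p n} → Prime p → p ∣ n → n ≢ 0 → 1 < n
prime∣∧≢0⇒1< {n = 0} _ _ n≢0 = contradiction refl n≢0
prime∣∧≢0⇒1< {n = 1} p-prime p∣1 _ = contradiction refl (prime∣⇒≢1 p-prime p∣1)
prime∣∧≢0⇒1< {n = suc (suc _)} _ _ _ = s≤s (s≤s z≤n)

common-prime⇒1<gcd : ∀ {p m n} → Prime p → p ∣ m → p ∣ n → 0 < m → 1 < gcd m n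
common-prime⇒1<gcd {m = m} {n} p-prime p∣m p∣n 0<m =
  prime∣∧≢0⇒1< p-prime (gcd-greatest p∣m p∣n) (gcd[m,n]≢0 m n (inj₁ (n>0⇒n≢0 0<m)))

distinct-primes-coprime : ∀ {p q} → Prime p → Prime q → p ≢ q → Coprime p q
distinct-primes-coprime p-prime q-prime p≢q (d∣p , d∣q)
  with prime⇒irreducible p-prime d∣p | prime⇒irreducible q-prime d∣q
... | inj₁ d≡1 | _ = d≡1
... | inj₂ _ | inj₁ d≡1 = d≡1
... | inj₂ d≡p | inj₂ d≡q = contradiction (trans (sym d≡p) d≡q) p≢q

distinct-primes-*-∣ : ∀ {p q n} → Prime p → Prime q → p ≢ q → p ∣ n → q ∣ n → p * q ∣ n
distinct-primes-*-∣ {p} {q} p-prime q-prime p≢q (divides k refl) q∣k*p =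
  subst (_∣ k * p) (*-comm q p) (*-monoˡ-∣ p q∣k)
  where
  q∣k : q ∣ k
  q∣k = coprime-divisor (distinct-primes-coprime q-prime p-prime (≢-sym p≢q))
          (subst (q ∣_) (*-comm k p) q∣k*p)

injective₃ : ∀ {A : Set} (f : Fin 3 → A) →
  f 0F ≢ f 1F → f 1F ≢ f 2F → f 0F ≢ f 2F → Injective _≡_ _≡_ f
injective₃ _ _ _ _ {0F} {0F} _ = refl
injective₃ _ _ _ _ {1F} {1F} _ = refl
injective₃ _ _ _ _ {2F} {2F} _ = refl
injective₃ _ f0≢f1 f1≢f2 f0≢f2 {0F} {1F} eq = contradiction eq f0≢f1
injective₃ _ f0≢f1 f1≢f2 f0≢f2 {1F} {0F} eq = contradiction (sym eq) f0≢f1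
injective₃ _ f0≢f1 f1≢f2 f0≢f2 {1F} {2F} eq = contradiction eq f1≢f2
injective₃ _ f0≢f1 f1≢f2 f0≢f2 {2F} {1F} eq = contradiction (sym eq) f1≢f2
injective₃ _ f0≢f1 f1≢f2 f0≢f2 {0F} {2F} eq = contradiction eq f0≢f2
injective₃ _ f0≢f1 f1≢f2 f0≢f2 {2F} {0F} eq = contradiction (sym eq) f0≢f2

fill-diagonal : ∀ {n} {R : Fin n → Fin n → Set} → (∀ i j → i ≢ j → R i j) →
  ∀ i j → (i ≡ j → R i j) → R i j
fill-diagonal off-diagonal i j diagonal with i ≟ j
... | yes i≡j = diagonal i≡j
... | no i≢j = off-diagonal i j i≢j

_⇔?_ : ∀ {A B : Set} → Dec A → Dec B → Dec (A ⇔ B)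
a? ⇔? b? = map′ (λ (f , g) → mk⇔ f g) (λ e → Equivalence.to e , Equivalence.from e)
                ((a? →-dec b?) ×-dec (b? →-dec a?))

-- The implicit argument is solved by evaluation exactly when the finite check succeeds.
decide-∀₂ : ∀ {k} {R : Fin k → Fin k → Set} (R? : ∀ u v → Dec (R u v)) →
  {True (all? λ u → all? (R? u))} → ∀ u v → R u v
decide-∀₂ R? {holds} = toWitness holds

C6Adj? : ∀ i j → Dec (C6Adj i j)
C6Adj? i j = (toℕ j ℕ.≟ suc (toℕ i) % 6) ⊎-dec (toℕ i ℕ.≟ suc (toℕ j) % 6)

K13Adj? : ∀ i j → Dec (K13Adj i j)
K13Adj? i j = (i ≟ 0F ×-dec ¬? (j ≟ 0F)) ⊎-dec (j ≟ 0F ×-dec ¬? (i ≟ 0F))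

-- C₆ and K₁,₃ are presented through their bipartite adjacency relation S; an
-- induced copy in B(X) then comes from families of primes and numbers whose
-- divisibility pattern is S.
Incidence : ∀ {m n} → (Fin m → Fin n → Set) → Fin m ⊎ Fin n → Fin m ⊎ Fin n → Set
Incidence S (inj₁ i) (inj₂ j) = S i j
Incidence S (inj₂ j) (inj₁ i) = S i j
Incidence S (inj₁ _) (inj₁ _) = ⊥
Incidence S (inj₂ _) (inj₂ _) = ⊥

incidence? : ∀ {m n} {S : Fin m → Fin n → Set} → (∀ i j → Dec (S i j)) →
  ∀ a b → Dec (Incidence S a b)
incidence? S? (inj₁ i) (inj₂ j) = S? i j
incidence? S? (inj₂ j) (inj₁ i) = S? i j
incidence? _ (inj₁ _) (inj₁ _) = no id
incidence? _ (inj₂ _) (inj₂ _) = no id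

hexagon : Fin 6 → Fin 3 ⊎ Fin 3
hexagon 0F = inj₁ 0F
hexagon 1F = inj₂ 1F
hexagon 2F = inj₁ 2F
hexagon 3F = inj₂ 0F
hexagon 4F = inj₁ 1F
hexagon 5F = inj₂ 2F

hexagon-injective : ∀ u v → hexagon u ≡ hexagon v → u ≡ v
hexagon-injective =
  decide-∀₂ (λ u v → ≡-dec _≟_ _≟_ (hexagon u) (hexagon v) →-dec (u ≟ v))

hexagon-shape : ∀ u v → Incidence _≢_ (hexagon u) (hexagon v) ⇔ C6Adj u v
hexagon-shape = decide-∀₂ λ u v →
  incidence? (λ i j → ¬? (i ≟ j)) (hexagon u) (hexagon v) ⇔? C6Adj? u v

Complete : ∀ {m n} → Fin m → Fin n → Set
Complete _ _ = ⊤

claw-left : Fin 4 → Fin 1 ⊎ Fin 3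
claw-left 0F = inj₁ 0F
claw-left (suc j) = inj₂ j

claw-right : Fin 4 → Fin 3 ⊎ Fin 1
claw-right 0F = inj₂ 0F
claw-right (suc i) = inj₁ i

claw-left-injective : ∀ u v → claw-left u ≡ claw-left v → u ≡ v
claw-left-injective =
  decide-∀₂ (λ u v → ≡-dec _≟_ _≟_ (claw-left u) (claw-left v) →-dec (u ≟ v))

claw-right-injective : ∀ u v → claw-right u ≡ claw-right v → u ≡ v
claw-right-injective =
  decide-∀₂ (λ u v → ≡-dec _≟_ _≟_ (claw-right u) (claw-right v) →-dec (u ≟ v))

claw-left-shape : ∀ u v → Incidence Complete (claw-left u) (claw-left v) ⇔ K13Adj u v
claw-left-shape = decide-∀₂ λ u v →
  incidence? (λ _ _ → yes tt) (claw-left u) (claw-left v) ⇔? K13Adj? u v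

claw-right-shape : ∀ u v → Incidence Complete (claw-right u) (claw-right v) ⇔ K13Adj u v
claw-right-shape = decide-∀₂ λ u v →
  incidence? (λ _ _ → yes tt) (claw-right u) (claw-right v) ⇔? K13Adj? u v

module _ {X : NatSet} where

  _∼_ : BVert X → BVert X → Set
  _∼_ = BAdj {X}

  label : BVert X → ℕ ⊎ ℕ
  label = BLabel {X}

  ρX X* : Set
  ρX = Σ ℕ (InRho X)
  X* = Σ ℕ (InXStar X)

  module _ {m n} (P : Fin m → ρX) (N : Fin n → X*) where

    label-injective : Injective _≡_ _≡_ (proj₁ ∘ P) → Injective _≡_ _≡_ (proj₁ ∘ N) →
      ∀ a b → label (Sum.map P N a) ≡ label (Sum.map P N b) → a ≡ b
    label-injective P-inj N-inj (inj₁ i) (inj₁ j) eq = cong inj₁ (P-inj (inj₁-injective eq))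
    label-injective P-inj N-inj (inj₂ i) (inj₂ j) eq = cong inj₂ (N-inj (inj₂-injective eq))
    label-injective _ _ (inj₁ _) (inj₂ _) ()
    label-injective _ _ (inj₂ _) (inj₁ _) ()

    adjacency-incidence : ∀ {S : Fin m → Fin n → Set} →
      (∀ i j → proj₁ (P i) ∣ proj₁ (N j) ⇔ S i j) →
      ∀ a b → Sum.map P N a ∼ Sum.map P N b ⇔ Incidence S a b
    adjacency-incidence P∣N⇔S (inj₁ i) (inj₂ j) = P∣N⇔S i j
    adjacency-incidence P∣N⇔S (inj₂ j) (inj₁ i) = P∣N⇔S i j
    adjacency-incidence _ (inj₁ _) (inj₁ _) = mk⇔ id id
    adjacency-incidence _ (inj₂ _) (inj₂ _) = mk⇔ id id

    induced-by-incidence : ∀ {k} {H : Fin k → Fin k → Set} {S : Fin m → Fin n → Set}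
      (σ : Fin k → Fin m ⊎ Fin n) →
      Injective _≡_ _≡_ (proj₁ ∘ P) → Injective _≡_ _≡_ (proj₁ ∘ N) →
      (∀ i j → proj₁ (P i) ∣ proj₁ (N j) ⇔ S i j) →
      (∀ u v → σ u ≡ σ v → u ≡ v) →
      (∀ u v → Incidence S (σ u) (σ v) ⇔ H u v) →
      InducedIn X k H
    induced-by-incidence σ P-inj N-inj P∣N⇔S σ-inj shape =
      Sum.map P N ∘ σ ,
      (λ u v → σ-inj u v ∘ label-injective P-inj N-inj (σ u) (σ v)) ,
      (λ u v → shape u v ⇔-∘ adjacency-incidence P∣N⇔S (σ u) (σ v))

  single-injective : ∀ {A : Set} {f : Fin 1 → A} → Injective _≡_ _≡_ f
  single-injective {x = 0F} {y = 0F} _ = refl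

  claw-at-prime : (c : ρX) (N : Fin 3 → X*) → Injective _≡_ _≡_ (proj₁ ∘ N) →
    (∀ j → proj₁ c ∣ proj₁ (N j)) → InducedIn X 4 K13Adj
  claw-at-prime c N N-inj c∣N =
    induced-by-incidence (const c) N claw-left single-injective N-inj
      (λ _ j → mk⇔ (const tt) (const (c∣N j))) claw-left-injective claw-left-shape

  claw-at-number : (c : X*) (P : Fin 3 → ρX) → Injective _≡_ _≡_ (proj₁ ∘ P) →
    (∀ i → proj₁ (P i) ∣ proj₁ c) → InducedIn X 4 K13Adj
  claw-at-number c P P-inj P∣c =
    induced-by-incidence P (const c) claw-right P-inj single-injective
      (λ i _ → mk⇔ (const tt) (const (P∣c i))) claw-right-injective claw-right-shape

  hexagon-induced : (P : Fin 3 → ρX) (N : Fin 3 → X*) →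
    Injective _≡_ _≡_ (proj₁ ∘ P) → Injective _≡_ _≡_ (proj₁ ∘ N) →
    (∀ i j → proj₁ (P i) ∣ proj₁ (N j) ⇔ i ≢ j) → InducedIn X 6 C6Adj
  hexagon-induced P N P-inj N-inj P∣N⇔≢ =
    induced-by-incidence P N hexagon P-inj N-inj P∣N⇔≢ hexagon-injective hexagon-shape

  cycle-or-claw : (P : Fin 3 → ρX) (N : Fin 3 → X*) →
    (∀ i j → i ≢ j → proj₁ (P i) ∣ proj₁ (N j)) →
    Injective _≡_ _≡_ (proj₁ ∘ P) ⊎ Injective _≡_ _≡_ (proj₁ ∘ N) →
    InducedIn X 6 C6Adj ⊎ InducedIn X 4 K13Adj
  cycle-or-claw P N off-diagonal injective
    with any? (λ k → proj₁ (P k) ∣? proj₁ (N k)) | injective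
  ... | yes (k , Pk∣Nk) | inj₁ P-inj =
    inj₂ (claw-at-number (N k) P P-inj (λ i → fill-diagonal off-diagonal i k λ { refl → Pk∣Nk }))
  ... | yes (k , Pk∣Nk) | inj₂ N-inj =
    inj₂ (claw-at-prime (P k) N N-inj (λ j → fill-diagonal off-diagonal k j λ { refl → Pk∣Nk }))
  ... | no ¬diagonal | _ =
    inj₁ (hexagon-induced P N P-inj N-inj
      (λ i j → mk⇔ (λ Pi∣Nj → λ { refl → ¬diagonal (i , Pi∣Nj) }) (off-diagonal i j)))
    where
    P-inj : Injective _≡_ _≡_ (proj₁ ∘ P)
    P-inj {i} {j} Pi≡Pj with i ≟ j
    ... | yes i≡j = i≡j
    ... | no i≢j = contradiction (j , subst (_∣ _) Pi≡Pj (off-diagonal i j i≢j)) ¬diagonal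
    N-inj : Injective _≡_ _≡_ (proj₁ ∘ N)
    N-inj {i} {j} Ni≡Nj with i ≟ j
    ... | yes i≡j = i≡j
    ... | no i≢j = contradiction (j , subst (_ ∣_) Ni≡Nj (off-diagonal j i (≢-sym i≢j))) ¬diagonal

  DeltaTriangle⇒induced : DeltaTriangle X → InducedIn X 6 C6Adj ⊎ InducedIn X 4 K13Adj
  DeltaTriangle⇒induced
    (p , q , r , ρp , ρq , ρr , (p≢q , x , Xx , pq∣x) , (q≢r , y , Xy , qr∣y) , (p≢r , z , Xz , pr∣z)) =
    cycle-or-claw P N off-diagonal (inj₁ (injective₃ (proj₁ ∘ P) p≢q q≢r p≢r))
    where
    p∣x = m*n∣⇒m∣ p q pq∣x
    q∣x = m*n∣⇒n∣ p q pq∣x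
    q∣y = m*n∣⇒m∣ q r qr∣y
    r∣y = m*n∣⇒n∣ q r qr∣y
    p∣z = m*n∣⇒m∣ p r pr∣z
    r∣z = m*n∣⇒n∣ p r pr∣z
    P : Fin 3 → ρX
    P 0F = p , ρp
    P 1F = q , ρq
    P 2F = r , ρr
    N : Fin 3 → X*
    N 0F = y , Xy , prime∣⇒≢1 (proj₁ ρq) q∣y
    N 1F = z , Xz , prime∣⇒≢1 (proj₁ ρp) p∣z
    N 2F = x , Xx , prime∣⇒≢1 (proj₁ ρp) p∣x
    off-diagonal : ∀ i j → i ≢ j → proj₁ (P i) ∣ proj₁ (N j)
    off-diagonal 0F 1F _ = p∣z
    off-diagonal 0F 2F _ = p∣x
    off-diagonal 1F 0F _ = q∣y
    off-diagonal 1F 2F _ = q∣x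
    off-diagonal 2F 0F _ = r∣y
    off-diagonal 2F 1F _ = r∣z
    off-diagonal 0F 0F 0≢0 = contradiction refl 0≢0
    off-diagonal 1F 1F 1≢1 = contradiction refl 1≢1
    off-diagonal 2F 2F 2≢2 = contradiction refl 2≢2

  GammaTriangle⇒induced : GammaTriangle X → InducedIn X 6 C6Adj ⊎ InducedIn X 4 K13Adj
  GammaTriangle⇒induced
    (x , y , z , x* , y* , z* , (x≢y , 1<gcd[x,y]) , (y≢z , 1<gcd[y,z]) , (x≢z , 1<gcd[x,z]))
    with common-prime-divisor 1<gcd[y,z] | common-prime-divisor 1<gcd[x,z] | common-prime-divisor 1<gcd[x,y]
  ... | p , p-prime , p∣y , p∣z | q , q-prime , q∣x , q∣z | r , r-prime , r∣x , r∣y =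
    cycle-or-claw P N off-diagonal (inj₂ (injective₃ (proj₁ ∘ N) x≢y y≢z x≢z))
    where
    N : Fin 3 → X*
    N 0F = x , x*
    N 1F = y , y*
    N 2F = z , z*
    P : Fin 3 → ρX
    P 0F = p , p-prime , y , proj₁ y* , p∣y
    P 1F = q , q-prime , x , proj₁ x* , q∣x
    P 2F = r , r-prime , x , proj₁ x* , r∣x
    off-diagonal : ∀ i j → i ≢ j → proj₁ (P i) ∣ proj₁ (N j)
    off-diagonal 0F 1F _ = p∣y
    off-diagonal 0F 2F _ = p∣z
    off-diagonal 1F 0F _ = q∣x
    off-diagonal 1F 2F _ = q∣z
    off-diagonal 2F 0F _ = r∣x
    off-diagonal 2F 1F _ = r∣y
    off-diagonal 0F 0F 0≢0 = contradiction refl 0≢0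
    off-diagonal 1F 1F 1≢1 = contradiction refl 1≢1
    off-diagonal 2F 2F 2≢2 = contradiction refl 2≢2

  DeltaGammaAdj : BVert X → BVert X → Set
  DeltaGammaAdj (inj₁ p) (inj₁ q) = DeltaAdj X (proj₁ p) (proj₁ q)
  DeltaGammaAdj (inj₂ x) (inj₂ y) = GammaAdj (proj₁ x) (proj₁ y)
  DeltaGammaAdj (inj₁ _) (inj₂ _) = ⊥
  DeltaGammaAdj (inj₂ _) (inj₁ _) = ⊥

  DeltaGammaAdj-triangle : ∀ {u v w} → DeltaGammaAdj u v → DeltaGammaAdj v w → DeltaGammaAdj u w →
    DeltaTriangle X ⊎ GammaTriangle X
  DeltaGammaAdj-triangle {inj₁ (p , ρp)} {inj₁ (q , ρq)} {inj₁ (r , ρr)} pq qr pr =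
    inj₁ (p , q , r , ρp , ρq , ρr , pq , qr , pr)
  DeltaGammaAdj-triangle {inj₂ (x , x*)} {inj₂ (y , y*)} {inj₂ (z , z*)} xy yz xz =
    inj₂ (x , y , z , x* , y* , z* , xy , yz , xz)
  DeltaGammaAdj-triangle {inj₁ _} {inj₂ _} ()
  DeltaGammaAdj-triangle {inj₂ _} {inj₁ _} ()
  DeltaGammaAdj-triangle {inj₁ _} {inj₁ _} {inj₂ _} _ ()
  DeltaGammaAdj-triangle {inj₂ _} {inj₂ _} {inj₁ _} _ ()

  module _ (positive : ∀ x → X x → 0 < x) where

    common-neighbour⇒DeltaGammaAdj : ∀ {u w v} → u ∼ w → w ∼ v → label u ≢ label v → DeltaGammaAdj u v
    common-neighbour⇒DeltaGammaAdj {inj₁ (p , ρp)} {inj₂ (n , Xn , _)} {inj₁ (q , ρq)} p∣n q∣n p≢q =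
      p≢q ∘ cong inj₁ , n , Xn , distinct-primes-*-∣ (proj₁ ρp) (proj₁ ρq) (p≢q ∘ cong inj₁) p∣n q∣n
    common-neighbour⇒DeltaGammaAdj {inj₂ (x , Xx , _)} {inj₁ (p , ρp)} {inj₂ (y , _)} p∣x p∣y x≢y =
      x≢y ∘ cong inj₂ , common-prime⇒1<gcd (proj₁ ρp) p∣x p∣y (positive x Xx)
    common-neighbour⇒DeltaGammaAdj {inj₁ _} {inj₁ _} ()
    common-neighbour⇒DeltaGammaAdj {inj₂ _} {inj₂ _} ()
    common-neighbour⇒DeltaGammaAdj {_} {inj₁ _} {inj₁ _} _ ()
    common-neighbour⇒DeltaGammaAdj {_} {inj₂ _} {inj₂ _} _ ()

    induced-common-neighbour : ∀ {k} {H : Fin k → Fin k → Set} ((f , _) : InducedIn X k H) →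
      ∀ {i l j} → H i l → H l j → i ≢ j → DeltaGammaAdj (f i) (f j)
    induced-common-neighbour (f , f-inj , f-adj) {i} {l} {j} il lj i≢j =
      common-neighbour⇒DeltaGammaAdj (Equivalence.from (f-adj i l) il) (Equivalence.from (f-adj l j) lj)
        (i≢j ∘ f-inj i j)

    C6⇒triangle : InducedIn X 6 C6Adj → DeltaTriangle X ⊎ GammaTriangle X
    C6⇒triangle c6 = DeltaGammaAdj-triangle
      (induced-common-neighbour c6 {0F} {1F} {2F} (inj₁ refl) (inj₁ refl) λ ())
      (induced-common-neighbour c6 {2F} {3F} {4F} (inj₁ refl) (inj₁ refl) λ ())
      (induced-common-neighbour c6 {0F} {5F} {4F} (inj₂ refl) (inj₂ refl) λ ())

    K13⇒triangle : InducedIn X 4 K13Adj → DeltaTriangle X ⊎ GammaTriangle X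
    K13⇒triangle k13 = DeltaGammaAdj-triangle
      (induced-common-neighbour k13 {1F} {0F} {2F} leaf-centre centre-leaf λ ())
      (induced-common-neighbour k13 {2F} {0F} {3F} leaf-centre centre-leaf λ ())
      (induced-common-neighbour k13 {1F} {0F} {3F} leaf-centre centre-leaf λ ())
      where
      leaf-centre : ∀ {i} → K13Adj (suc i) 0F
      leaf-centre = inj₂ (refl , λ ())
      centre-leaf : ∀ {j} → K13Adj 0F (suc j)
      centre-leaf = inj₁ (refl , λ ())

theorem4p1 : (X : NatSet) →
    (∀ x → X x → 0 < x) →
    (∃ λ x → X x) →
    ¬ (∀ x → X x ⇔ (x ≡ 1)) →
    ((DeltaTriangle X ⊎ GammaTriangle X) ⇔ (InducedIn X 6 C6Adj ⊎ InducedIn X 4 K13Adj))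
theorem4p1 X positive _ _ =
  mk⇔ [ DeltaTriangle⇒induced , GammaTriangle⇒induced ]
      [ C6⇒triangle positive , K13⇒triangle positive ]
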